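{- Let $n\geq1$ be an integer, $x\in[\frac1n,1]$ and $k=[nx]$ (integer part). Then $$\frac{(n-[nx])!}{n\cdot n!}\leq \frac{c(n,k)}{n!}\leq \frac{2^n}{[nx]!}.$$
   Context: For a permutation $\sigma=a_1\cdots a_n$ of $\{1,\dots,n\}$, a record is a value $a_j$ with $a_i<a_j$ for all $i<j$. $c(n,k)$ denotes the number of permutations of $\{1,\dots,n\}$ having exactly $k$ records. -}

module Defs where

open import Data.Nat using (ℕ; zero; suc; _∸_; _*_; _^_; _!; _<_; _<?_; NonZero)
open import Data.Nat.Properties using (_≟_; _!≢0; m*n≢0)
open import Data.List using (List; []; _∷_; _++_; [_]; map; concatMap; upTo; length; filter)
open import Data.List.Relation.Unary.All using (All; all?)
open import Data.List.Relation.Unary.Unique.Propositional using (Unique)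
open import Data.List.Relation.Unary.Unique.DecPropositional _≟_ using (unique?)
open import Data.Integer using (+_)
open import Data.Rational using (ℚ; _/_)
open import Relation.Nullary.Decidable using (does; _×-dec_)
open import Data.Bool using (if_then_else_)

words : ℕ → ℕ → List (List ℕ)
words a zero    = [] ∷ []
words a (suc m) = concatMap (λ x → map (x ∷_) (words a m)) (upTo a)

-- Permutations of {0,...,n-1} (order-isomorphic to {1,...,n}) in one-line
-- notation a₁⋯aₙ: the words of length n over {0,...,n-1} with no repeated letter.
perms : ℕ → List (List ℕ)
perms n = filter unique? (words n n)

recordsFrom : List ℕ → List ℕ → ℕ
recordsFrom pre []      = 0
recordsFrom pre (a ∷ w) =
  if does (all? (_<? a) pre) then suc (recordsFrom (pre ++ [ a ]) w)
                             else recordsFrom (pre ++ [ a ]) w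

records : List ℕ → ℕ
records w = recordsFrom [] w

c : ℕ → ℕ → ℕ
c n k = length (filter (λ σ → records σ ≟ k) (perms n))

-- The three rational quantities of the lemma, with k = [nx].
lowerQ : (n k : ℕ) → .{{NonZero n}} → ℚ
lowerQ n k {{nz}} = ((+ ((n ∸ k) !)) / (n * n !)) {{m*n≢0 n (n !) {{nz}} {{n !≢0}}}}

middleQ : ℕ → ℕ → ℚ
middleQ n k = ((+ c n k) / (n !)) {{n !≢0}}

upperQ : ℕ → ℕ → ℚ
upperQ n k = ((+ (2 ^ n)) / (k !)) {{k !≢0}}

module Submission where

-- Every permutation of {0..n} is uniquely a permutation σ of {0..n-1} whose values
-- are shifted up past some a ≤ n, followed by the last letter a.  The shift
-- preserves the records of σ, and the last letter is a record iff a = n, so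
-- c(n+1,k) = n c(n,k) + c(n,k-1).  Both bounds then follow by induction on n:
-- (n-k)! ≤ c(n,k) and c(n,k) k! ≤ 2ⁿ n!.

open import Defs
open import Data.Bool using (true; false; if_then_else_)
open import Data.Empty using (⊥)
open import Data.Integer as ℤ using (+≤+)
open import Data.Integer.Properties using (pos-*)
open import Data.List
  using (List; []; _∷_; _++_; [_]; map; concatMap; upTo; length; filter; initLast; _∷ʳ′_)
open import Data.List.Membership.Propositional using (_∈_; lose; find)
open import Data.List.Membership.Propositional.Properties
  using (∈-map⁺; ∈-map⁻; ∈-concatMap⁺; ∈-concatMap⁻; ∈-upTo⁺; ∈-upTo⁻; ∈-filter⁺; ∈-filter⁻)
open import Data.List.Membership.Propositional.Properties.WithK using (unique∧set⇒bag)
open import Data.List.Properties as List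
  using (map-++; ++-assoc; ++-identityʳ; length-++; length-map; filter-++; filter-≐)
open import Data.List.Relation.Binary.BagAndSetEquality using (∼bag⇒↭)
open import Data.List.Relation.Binary.Permutation.Propositional using (_↭_)
open import Data.List.Relation.Binary.Permutation.Propositional.Properties using (↭-length; filter-↭)
open import Data.List.Relation.Unary.All as All using (All; []; _∷_; all?)
import Data.List.Relation.Unary.All.Properties as All
open import Data.List.Relation.Unary.AllPairs using ([]; _∷_)
open import Data.List.Relation.Unary.Any using (here)
open import Data.List.Relation.Unary.Unique.Propositional using (Unique)
import Data.List.Relation.Unary.Unique.Propositional.Properties as Unique
open import Data.Nat
  using (ℕ; zero; suc; pred; _+_; _*_; _^_; _∸_; _<_; _≤_; _<?_; z≤n; s≤s; _!; NonZero)
open import Data.Nat.Properties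
open import Data.Nat.Solver using (module +-*-Solver)
open import Data.List.Relation.Unary.Unique.DecPropositional _≟_ using (unique?)
open import Data.Product using (_×_; _,_; proj₂)
open import Data.Rational using (_/_; toℚᵘ) renaming (_≤_ to _≤ℚ_)
open import Data.Rational.Properties using (toℚᵘ-cancel-≤; toℚᵘ-fromℚᵘ)
open import Data.Rational.Unnormalised using (mkℚᵘ; *≤*)
import Data.Rational.Unnormalised.Properties as ℚᵘ
open import Function using (_∘_)
open import Function.Bundles using (_⇔_; mk⇔; module Equivalence)
open import Relation.Binary.Definitions using (tri<; tri≈; tri>)
open import Relation.Nullary using (¬_; yes; no; does; contradiction)
open import Relation.Nullary.Decidable using (dec-true; dec-false; does-⇔)
open import Relation.Binary.PropositionalEquality
  using (_≡_; _≢_; refl; sym; trans; cong; cong₂; subst; subst₂; module ≡-Reasoning)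

∈-words⁻ : ∀ a m {w} → w ∈ words a m → length w ≡ m × All (_< a) w
∈-words⁻ a zero    (here refl) = refl , []
∈-words⁻ a (suc m) w∈ with find (∈-concatMap⁻ (λ x → map (x ∷_) (words a m)) {xs = upTo a} w∈)
... | x , x∈ , w∈′ with ∈-map⁻ (x ∷_) w∈′
... | v , v∈ , refl with ∈-words⁻ a m v∈
... | |v|≡m , v<a = cong suc |v|≡m , ∈-upTo⁻ x∈ ∷ v<a

∈-words⁺ : ∀ a {w} → All (_< a) w → w ∈ words a (length w)
∈-words⁺ a []                 = here refl
∈-words⁺ a {x ∷ w} (x<a ∷ w<a) =
  ∈-concatMap⁺ (λ y → map (y ∷_) (words a (length w))) {xs = upTo a}
    (lose (∈-upTo⁺ x<a) (∈-map⁺ (x ∷_) (∈-words⁺ a w<a)))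

Unique-concatMap : ∀ {A B : Set} (f : A → List B) {xs : List A} →
  Unique xs → (∀ x → Unique (f x)) → (∀ {x y z} → z ∈ f x → z ∈ f y → x ≡ y) →
  Unique (concatMap f xs)
Unique-concatMap f {[]}     _          _        _     = []
Unique-concatMap f {x ∷ xs} (x∉ ∷ !xs) !f images-disjoint =
  Unique.++⁺ (!f x) (Unique-concatMap f !xs !f images-disjoint) disjoint
  where
  disjoint : ∀ {z} → z ∈ f x × z ∈ concatMap f xs → ⊥
  disjoint (z∈fx , z∈fxs) with find (∈-concatMap⁻ f {xs = xs} z∈fxs)
  ... | y , y∈xs , z∈fy = All.lookup x∉ y∈xs (images-disjoint z∈fx z∈fy)

words-unique : ∀ a m → Unique (words a m)
words-unique a zero    = [] ∷ []
words-unique a (suc m) =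
  Unique-concatMap (λ x → map (x ∷_) (words a m)) (Unique.upTo⁺ a)
    (λ x → Unique.map⁺ (proj₂ ∘ List.∷-injective) (words-unique a m)) same-head
  where
  same-head : ∀ {x y z} → z ∈ map (x ∷_) (words a m) → z ∈ map (y ∷_) (words a m) → x ≡ y
  same-head z∈x z∈y with ∈-map⁻ _ z∈x | ∈-map⁻ _ z∈y
  ... | _ , _ , refl | _ , _ , eq = List.∷-injectiveˡ eq

IsPerm : ℕ → List ℕ → Set
IsPerm n σ = Unique σ × All (_< n) σ × length σ ≡ n

∈-perms⁻ : ∀ n {σ} → σ ∈ perms n → IsPerm n σ
∈-perms⁻ n σ∈ with ∈-filter⁻ unique? {xs = words n n} σ∈
... | σ∈words , !σ with ∈-words⁻ n n σ∈words
... | |σ|≡n , σ<n = !σ , σ<n , |σ|≡n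

∈-perms⁺ : ∀ n {σ} → IsPerm n σ → σ ∈ perms n
∈-perms⁺ n (!σ , σ<n , refl) = ∈-filter⁺ unique? (∈-words⁺ n σ<n) !σ

perms-unique : ∀ n → Unique (perms n)
perms-unique n = Unique.filter⁺ unique? (words-unique n n)

All-perms : ∀ n {P : List ℕ → Set} → (∀ {σ} → IsPerm n σ → P σ) → All P (perms n)
All-perms n f = All.tabulate (f ∘ ∈-perms⁻ n)

punchIn : ℕ → ℕ → ℕ
punchIn a x with x <? a
... | yes _ = x
... | no  _ = suc x

punchOut : ℕ → ℕ → ℕ
punchOut a x with x <? a
... | yes _ = x
... | no  _ = pred x

punchIn-< : ∀ {a x} → x < a → punchIn a x ≡ x
punchIn-< {a} {x} x<a with x <? a
... | yes _   = refl
... | no  x≮a = contradiction x<a x≮a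

punchIn-≥ : ∀ {a x} → a ≤ x → punchIn a x ≡ suc x
punchIn-≥ {a} {x} a≤x with x <? a
... | yes x<a = contradiction a≤x (<⇒≱ x<a)
... | no  _   = refl

≤punchIn : ∀ a x → x ≤ punchIn a x
≤punchIn a x with x <? a
... | yes _ = ≤-refl
... | no  _ = n≤1+n x

punchIn≤suc : ∀ a x → punchIn a x ≤ suc x
punchIn≤suc a x with x <? a
... | yes _ = n≤1+n x
... | no  _ = ≤-refl

punchIn≢ : ∀ a x → punchIn a x ≢ a
punchIn≢ a x with x <? a
... | yes x<a = <⇒≢ x<a
... | no  x≮a = λ x+1≡a → x≮a (subst (x <_) x+1≡a (n<1+n x))

punchIn-mono-< : ∀ a {x y} → x < y → punchIn a x < punchIn a y
punchIn-mono-< a {x} {y} x<y with x <? a | y <? a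
... | yes _   | yes _   = x<y
... | yes x<a | no  y≮a = <-≤-trans x<a (≤-trans (≮⇒≥ y≮a) (n≤1+n y))
... | no  x≮a | yes y<a = contradiction (<-trans x<y y<a) x≮a
... | no  _   | no  _   = s≤s x<y

punchIn-cancel-< : ∀ a {x y} → punchIn a x < punchIn a y → x < y
punchIn-cancel-< a {x} {y} p<p with <-cmp x y
... | tri< x<y _ _ = x<y
... | tri≈ _ refl _ = contradiction p<p (<-irrefl refl)
... | tri> _ _ y<x = contradiction p<p (<-asym (punchIn-mono-< a y<x))

punchIn-injective : ∀ a {x y} → punchIn a x ≡ punchIn a y → x ≡ y
punchIn-injective a {x} {y} p≡p with <-cmp x y
... | tri< x<y _ _ = contradiction p≡p (<⇒≢ (punchIn-mono-< a x<y))
... | tri≈ _ x≡y _ = x≡y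
... | tri> _ _ y<x = contradiction (sym p≡p) (<⇒≢ (punchIn-mono-< a y<x))

punchIn-punchOut : ∀ {a x} → x ≢ a → punchIn a (punchOut a x) ≡ x
punchIn-punchOut {a} {x} x≢a with x <? a
punchIn-punchOut {a} {x}     x≢a | yes x<a = punchIn-< x<a
punchIn-punchOut {a} {zero}  x≢a | no  x≮a = contradiction (≤∧≢⇒< z≤n x≢a) x≮a
punchIn-punchOut {a} {suc x} x≢a | no  x≮a =
  punchIn-≥ (≤-pred (≤∧≢⇒< (≮⇒≥ x≮a) (x≢a ∘ sym)))

punchOut-< : ∀ {a n x} → a ≤ n → x < suc n → x ≢ a → punchOut a x < n
punchOut-< {a} {n} {x} a≤n x≤n x≢a with x <? a
punchOut-< {a} {n} {x}     a≤n x≤n     x≢a | yes x<a = <-≤-trans x<a a≤n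
punchOut-< {a} {n} {zero}  a≤n x≤n     x≢a | no  x≮a = contradiction (≤∧≢⇒< z≤n x≢a) x≮a
punchOut-< {a} {n} {suc x} a≤n (s≤s x<n) x≢a | no _  = x<n

map-punchIn-punchOut : ∀ a v → All (_≢ a) v → map (punchIn a) (map (punchOut a) v) ≡ v
map-punchIn-punchOut a []      []          = refl
map-punchIn-punchOut a (x ∷ v) (x≢a ∷ v≢a) =
  cong₂ _∷_ (punchIn-punchOut x≢a) (map-punchIn-punchOut a v v≢a)

extend : ℕ → List ℕ → List ℕ
extend a σ = map (punchIn a) σ ++ [ a ]

extendPerms : ℕ → ℕ → List (List ℕ)
extendPerms n a = map (extend a) (perms n)

extensions : ℕ → List (List ℕ)
extensions n = concatMap (extendPerms n) (upTo (suc n))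

extend-perm : ∀ {n a σ} → a < suc n → IsPerm n σ → IsPerm (suc n) (extend a σ)
extend-perm {n} {a} {σ} a≤n (!σ , σ<n , |σ|≡n) =
  Unique.++⁺ (Unique.map⁺ (punchIn-injective a) !σ) ([] ∷ []) a∉ ,
  All.++⁺ (All.map⁺ (All.map (λ {x} x<n → ≤-<-trans (punchIn≤suc a x) (s≤s x<n)) σ<n)) (a≤n ∷ []) ,
  (begin
    length (map (punchIn a) σ ++ [ a ]) ≡⟨ length-++ (map (punchIn a) σ) ⟩
    length (map (punchIn a) σ) + 1      ≡⟨ cong (_+ 1) (trans (length-map (punchIn a) σ) |σ|≡n) ⟩
    n + 1                               ≡⟨ +-comm n 1 ⟩
    suc n                               ∎)
  where
  open ≡-Reasoning
  a∉ : ∀ {z} → z ∈ map (punchIn a) σ × z ∈ [ a ] → ⊥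
  a∉ (z∈ , here refl) with ∈-map⁻ (punchIn a) z∈
  ... | x , _ , a≡ = punchIn≢ a x (sym a≡)

extensions-unique : ∀ n → Unique (extensions n)
extensions-unique n =
  Unique-concatMap (extendPerms n) (Unique.upTo⁺ (suc n))
    (λ a → Unique.map⁺ (List.map-injective (punchIn-injective a) ∘ List.∷ʳ-injectiveˡ _ _)
                       (perms-unique n))
    same-last
  where
  same-last : ∀ {a b τ} → τ ∈ extendPerms n a → τ ∈ extendPerms n b → a ≡ b
  same-last τ∈a τ∈b with ∈-map⁻ _ τ∈a | ∈-map⁻ _ τ∈b
  ... | σ , _ , refl | ρ , _ , eq = List.∷ʳ-injectiveʳ (map (punchIn _) σ) (map (punchIn _) ρ) eq

Unique-∷ʳ⁻ : ∀ {A : Set} (w : List A) b → Unique (w ++ [ b ]) → Unique w × All (_≢ b) w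
Unique-∷ʳ⁻ []      b _           = [] , []
Unique-∷ʳ⁻ (x ∷ w) b (x∉ ∷ !wb) with Unique-∷ʳ⁻ w b !wb
... | !w , w≢b = (All.++⁻ˡ w x∉ ∷ !w) , (head (All.++⁻ʳ w x∉) ∷ w≢b)
  where
  head : All (x ≢_) [ b ] → x ≢ b
  head (x≢b ∷ []) = x≢b

∈-extensions⁺ : ∀ n {τ} → IsPerm (suc n) τ → τ ∈ extensions n
∈-extensions⁺ n {τ} (!τ , τ≤n , |τ|≡1+n) with initLast τ
∈-extensions⁺ n {.[]} (_ , _ , ()) | []
∈-extensions⁺ n {.(w ++ [ b ])} (!τ , τ≤n , |τ|≡1+n) | w ∷ʳ′ b with Unique-∷ʳ⁻ w b !τ
... | !w , w≢b = ∈-concatMap⁺ (extendPerms n) {xs = upTo (suc n)}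
                   (lose (∈-upTo⁺ b≤n) (subst (λ v → v ++ [ b ] ∈ extendPerms n b)
                                               (map-punchIn-punchOut b w w≢b)
                                               (∈-map⁺ (extend b) (∈-perms⁺ n σ-perm))))
  where
  b≤n : b < suc n
  b≤n = All.lookup (All.++⁻ʳ w τ≤n) (here refl)
  σ = map (punchOut b) w
  |w|≡n : length w ≡ n
  |w|≡n = suc-injective (trans (trans (+-comm 1 (length w)) (sym (length-++ w))) |τ|≡1+n)
  σ-perm : IsPerm n σ
  σ-perm = Unique.map⁻ (subst Unique (sym (map-punchIn-punchOut b w w≢b)) !w) ,
           All.map⁺ (All.zipWith (λ (x≤n , x≢b) → punchOut-< (≤-pred b≤n) x≤n x≢b)
                                 (All.++⁻ˡ w τ≤n , w≢b)) ,
           trans (length-map (punchOut b) w) |w|≡n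

∈-extensions⁻ : ∀ n {τ} → τ ∈ extensions n → IsPerm (suc n) τ
∈-extensions⁻ n τ∈ with find (∈-concatMap⁻ (extendPerms n) {xs = upTo (suc n)} τ∈)
... | a , a∈ , τ∈a with ∈-map⁻ (extend a) τ∈a
... | σ , σ∈ , refl = extend-perm (∈-upTo⁻ a∈) (∈-perms⁻ n σ∈)

perms-suc↭extensions : ∀ n → perms (suc n) ↭ extensions n
perms-suc↭extensions n = ∼bag⇒↭ (unique∧set⇒bag (perms-unique (suc n)) (extensions-unique n)
  (mk⇔ (∈-extensions⁺ n ∘ ∈-perms⁻ (suc n)) (∈-perms⁺ (suc n) ∘ ∈-extensions⁻ n)))

recordsFrom-++ : ∀ p u v → recordsFrom p (u ++ v) ≡ recordsFrom p u + recordsFrom (p ++ u) v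
recordsFrom-++ p []      v rewrite ++-identityʳ p = refl
recordsFrom-++ p (x ∷ u) v rewrite recordsFrom-++ (p ++ [ x ]) u v | ++-assoc p [ x ] u
  with does (all? (_<? x) p)
... | true  = refl
... | false = refl

All-map-< : ∀ (f : ℕ → ℕ) → (∀ {x y} → x < y ⇔ f x < f y) →
  ∀ {x} p → All (_< f x) (map f p) ⇔ All (_< x) p
All-map-< f f-<⇔ p =
  mk⇔ (All.map (Equivalence.from f-<⇔) ∘ All.map⁻) (All.map⁺ ∘ All.map (Equivalence.to f-<⇔))

recordsFrom-map : ∀ (f : ℕ → ℕ) → (∀ {x y} → x < y ⇔ f x < f y) →
  ∀ p w → recordsFrom (map f p) (map f w) ≡ recordsFrom p w
recordsFrom-map f f-<⇔ p []      = refl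
recordsFrom-map f f-<⇔ p (x ∷ w)
  rewrite sym (map-++ f p [ x ]) | recordsFrom-map f f-<⇔ (p ++ [ x ]) w
        | does-⇔ (All-map-< f f-<⇔ p) (all? (_<? f x) (map f p)) (all? (_<? x) p)
  with does (all? (_<? x) p)
... | true  = refl
... | false = refl

records-extend : ∀ a σ →
  records (extend a σ) ≡ records σ + (if does (all? (_<? a) (map (punchIn a) σ)) then 1 else 0)
records-extend a σ =
  trans (recordsFrom-++ [] (map (punchIn a) σ) [ a ])
        (cong (_+ recordsFrom (map (punchIn a) σ) [ a ])
              (recordsFrom-map (punchIn a) (mk⇔ (punchIn-mono-< a) (punchIn-cancel-< a)) [] σ))

Unique⇒length≤bound : ∀ m {xs} → Unique xs → All (_< m) xs → length xs ≤ m
Unique⇒length≤bound zero    {[]}    _   _          = z≤n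
Unique⇒length≤bound zero    {_ ∷ _} _   (() ∷ _)
Unique⇒length≤bound (suc m) {xs}    !xs xs≤m       = begin
  length xs                          ≤⟨ at-most-one-≥ xs !xs xs≤m ⟩
  suc (length (filter (_<? m) xs))   ≤⟨ s≤s (Unique⇒length≤bound m (Unique.filter⁺ (_<? m) !xs)
                                                                   (All.all-filter (_<? m) xs)) ⟩
  suc m                              ∎
  where
  open ≤-Reasoning
  at-most-one-≥ : ∀ xs → Unique xs → All (_< suc m) xs → length xs ≤ suc (length (filter (_<? m) xs))
  at-most-one-≥ []       _          _            = z≤n
  at-most-one-≥ (x ∷ xs) (x∉ ∷ !xs) (x≤m ∷ xs≤m) with x <? m
  ... | yes x<m rewrite List.filter-accept (_<? m) {xs = xs} x<m = s≤s (at-most-one-≥ xs !xs xs≤m)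
  ... | no  x≮m rewrite List.filter-reject (_<? m) {xs = xs} x≮m =
    s≤s (≤-reflexive (cong length (sym (List.filter-all (_<? m) xs<m))))
    where
    x≡m : x ≡ m
    x≡m = ≤-antisym (≤-pred x≤m) (≮⇒≥ x≮m)
    xs<m : All (_< m) xs
    xs<m = All.zipWith (λ (y≤m , x≢y) → ≤∧≢⇒< (≤-pred y≤m) (λ y≡m → x≢y (trans x≡m (sym y≡m))))
                       (xs≤m , x∉)

records-extend-< : ∀ {n a σ} → a < n → IsPerm n σ → records (extend a σ) ≡ records σ
records-extend-< {n} {a} {σ} a<n (!σ , _ , |σ|≡n) = begin
  records (extend a σ)
    ≡⟨ records-extend a σ ⟩
  records σ + (if does (all? (_<? a) (map (punchIn a) σ)) then 1 else 0)
    ≡⟨ cong (λ b → records σ + (if b then 1 else 0)) (dec-false (all? (_<? a) _) not-all-below) ⟩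
  records σ + 0
    ≡⟨ +-identityʳ (records σ) ⟩
  records σ
    ∎
  where
  open ≡-Reasoning
  not-all-below : ¬ All (_< a) (map (punchIn a) σ)
  not-all-below σ<a = <⇒≱ a<n (subst (_≤ a) |σ|≡n (Unique⇒length≤bound a !σ
    (All.map (λ {x} → ≤-<-trans (≤punchIn a x)) (All.map⁻ σ<a))))

records-extend-max : ∀ {n σ} → IsPerm n σ → records (extend n σ) ≡ suc (records σ)
records-extend-max {n} {σ} (_ , σ<n , _) = begin
  records (extend n σ)
    ≡⟨ records-extend n σ ⟩
  records σ + (if does (all? (_<? n) (map (punchIn n) σ)) then 1 else 0)
    ≡⟨ cong (λ b → records σ + (if b then 1 else 0)) (dec-true (all? (_<? n) _) all-below) ⟩
  records σ + 1
    ≡⟨ +-comm (records σ) 1 ⟩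
  suc (records σ)
    ∎
  where
  open ≡-Reasoning
  all-below : All (_< n) (map (punchIn n) σ)
  all-below = All.map⁺ (All.map (λ x<n → subst (_< n) (sym (punchIn-< x<n)) x<n) σ<n)

countBy : ∀ {A : Set} → (A → ℕ) → ℕ → List A → ℕ
countBy s k xs = length (filter (λ x → s x ≟ k) xs)

countBy-++ : ∀ {A : Set} (s : A → ℕ) k xs ys → countBy s k (xs ++ ys) ≡ countBy s k xs + countBy s k ys
countBy-++ s k xs ys = trans (cong length (filter-++ (λ x → s x ≟ k) xs ys)) (length-++ (filter _ xs))

countBy-↭ : ∀ {A : Set} (s : A → ℕ) k {xs ys} → xs ↭ ys → countBy s k xs ≡ countBy s k ys
countBy-↭ s k xs↭ys = ↭-length (filter-↭ (λ x → s x ≟ k) xs↭ys)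

countBy-map : ∀ {A B : Set} (s : B → ℕ) (t : A → ℕ) (f : A → B) k xs →
  All (λ x → s (f x) ≡ t x) xs → countBy s k (map f xs) ≡ countBy t k xs
countBy-map s t f k []       []               = refl
countBy-map s t f k (x ∷ xs) (sfx≡tx ∷ rest) with t x ≟ k
... | yes tx≡k
  rewrite List.filter-accept (λ y → s y ≟ k) {xs = map f xs} (trans sfx≡tx tx≡k)
        | List.filter-accept (λ y → t y ≟ k) {xs = xs} tx≡k
  = cong suc (countBy-map s t f k xs rest)
... | no tx≢k
  rewrite List.filter-reject (λ y → s y ≟ k) {xs = map f xs} (tx≢k ∘ trans (sym sfx≡tx))
        | List.filter-reject (λ y → t y ≟ k) {xs = xs} tx≢k
  = countBy-map s t f k xs rest

countBy-suc : ∀ {A : Set} (s : A → ℕ) k xs → countBy (suc ∘ s) (suc k) xs ≡ countBy s k xs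
countBy-suc s k xs =
  cong length (filter-≐ (λ x → suc (s x) ≟ suc k) (λ x → s x ≟ k) (suc-injective , cong suc) xs)

countBy-suc-zero : ∀ {A : Set} (s : A → ℕ) xs → countBy (suc ∘ s) 0 xs ≡ 0
countBy-suc-zero s []       = refl
countBy-suc-zero s (x ∷ xs) = countBy-suc-zero s xs

countBy-concatMap : ∀ {A B : Set} (s : B → ℕ) k (f : A → List B) v as →
  All (λ a → countBy s k (f a) ≡ v) as → countBy s k (concatMap f as) ≡ length as * v
countBy-concatMap s k f v []       []           = refl
countBy-concatMap s k f v (a ∷ as) (fa≡v ∷ rest) =
  trans (countBy-++ s k (f a) (concatMap f as)) (cong₂ _+_ fa≡v (countBy-concatMap s k f v as rest))

c-rec : ∀ n k → c (suc n) k ≡ n * c n k + countBy (suc ∘ records) k (perms n)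
c-rec n k = begin
  c (suc n) k
    ≡⟨ countBy-↭ records k (perms-suc↭extensions n) ⟩
  countBy records k (concatMap (extendPerms n) (upTo (suc n)))
    ≡⟨ cong (countBy records k) (trans (cong (concatMap (extendPerms n)) (sym (List.upTo-∷ʳ n)))
                                       (List.concatMap-++ (extendPerms n) (upTo n) [ n ])) ⟩
  countBy records k (concatMap (extendPerms n) (upTo n) ++ extendPerms n n ++ [])
    ≡⟨ countBy-++ records k (concatMap (extendPerms n) (upTo n)) _ ⟩
  countBy records k (concatMap (extendPerms n) (upTo n)) + countBy records k (extendPerms n n ++ [])
    ≡⟨ cong₂ _+_ non-maximal-last (cong (countBy records k) (++-identityʳ (extendPerms n n))) ⟩
  n * c n k + countBy records k (extendPerms n n)
    ≡⟨ cong ((n * c n k) +_) (countBy-map records (suc ∘ records) (extend n) k (perms n)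
                              (All-perms n records-extend-max)) ⟩
  n * c n k + countBy (suc ∘ records) k (perms n)
    ∎
  where
  open ≡-Reasoning
  non-maximal-last : countBy records k (concatMap (extendPerms n) (upTo n)) ≡ n * c n k
  non-maximal-last =
    trans (countBy-concatMap records k (extendPerms n) (c n k) (upTo n)
             (All.tabulate λ a∈ → countBy-map records records (extend _) k (perms n)
                                    (All-perms n (records-extend-< (∈-upTo⁻ a∈)))))
          (cong (_* c n k) (List.length-upTo n))

c-rec-zero : ∀ n → c (suc n) 0 ≡ n * c n 0
c-rec-zero n = trans (c-rec n 0) (trans (cong ((n * c n 0) +_) (countBy-suc-zero records (perms n)))
                                        (+-identityʳ (n * c n 0)))

c-rec-suc : ∀ n k → c (suc n) (suc k) ≡ n * c n (suc k) + c n k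
c-rec-suc n k = trans (c-rec n (suc k)) (cong ((n * c n (suc k)) +_) (countBy-suc records k (perms n)))

c-above : ∀ {n k} → n < k → c n k ≡ 0
c-above {zero}  {suc k} _ = refl
c-above {suc n} {suc k} (s≤s n<k)
  rewrite c-rec-suc n k | c-above (m<n⇒m<1+n n<k) | c-above n<k | *-zeroʳ n = refl

c-suc-zero : ∀ n → c (suc n) 0 ≡ 0
c-suc-zero zero    = c-rec-zero 0
c-suc-zero (suc n) rewrite c-rec-zero (suc n) | c-suc-zero n = *-zeroʳ (suc n)

c-diag : ∀ n → c n n ≡ 1
c-diag zero = refl
c-diag (suc n) rewrite c-rec-suc n n | c-above (n<1+n n) | c-diag n | *-zeroʳ n = refl

c-lower : ∀ j m → m ! ≤ c (suc j + m) (suc j)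
c-lower j zero    rewrite +-identityʳ j | c-diag (suc j) = ≤-refl
c-lower j (suc m) = begin
  suc m * m !
    ≤⟨ *-mono-≤ (m≤n+m (suc m) j) (c-lower j m) ⟩
  (j + suc m) * c (suc j + m) (suc j)
    ≡⟨ cong (λ t → (j + suc m) * c t (suc j)) (sym (+-suc j m)) ⟩
  (j + suc m) * c (j + suc m) (suc j)
    ≤⟨ m≤m+n _ _ ⟩
  (j + suc m) * c (j + suc m) (suc j) + c (j + suc m) j
    ≡⟨ sym (c-rec-suc (j + suc m) j) ⟩
  c (suc j + suc m) (suc j)
    ∎
  where open ≤-Reasoning

c-upper : ∀ n k → c n k * k ! ≤ 2 ^ n * n !
c-upper zero    zero    = ≤-refl
c-upper zero    (suc k) = z≤n
c-upper (suc n) zero    rewrite c-suc-zero n = z≤n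
c-upper (suc n) (suc k) = begin
  c (suc n) (suc k) * (suc k * k !)            ≡⟨ cong (_* (suc k * k !)) (c-rec-suc n k) ⟩
  (n * c n (suc k) + c n k) * (suc k * k !)    ≡⟨ solve 5 (λ n a b s f → (n :* a :+ b) :* (s :* f)
                                                     := n :* (a :* (s :* f)) :+ s :* (b :* f))
                                                     refl n (c n (suc k)) (c n k) (suc k) (k !) ⟩
  n * (c n (suc k) * suc k !) + suc k * (c n k * k !)
                                               ≤⟨ +-mono-≤ (*-monoʳ-≤ n (c-upper n (suc k))) shorter-term ⟩
  n * X + suc n * X                            ≤⟨ +-monoˡ-≤ (suc n * X) (*-monoˡ-≤ X (n≤1+n n)) ⟩
  suc n * X + suc n * X                        ≡⟨ solve 3 (λ m t f → m :* (t :* f) :+ m :* (t :* f)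
                                                     := (con 2 :* t) :* (m :* f))
                                                     refl (suc n) (2 ^ n) (n !) ⟩
  2 ^ suc n * (suc n * n !)                    ∎
  where
  open ≤-Reasoning
  open +-*-Solver
  X = 2 ^ n * n !
  shorter-term : suc k * (c n k * k !) ≤ suc n * X
  shorter-term with k ≤? n
  ... | yes k≤n = *-mono-≤ (s≤s k≤n) (c-upper n k)
  ... | no  k≰n rewrite c-above (≰⇒> k≰n) | *-zeroʳ k = z≤n

*≤*⇒/≤/ : ∀ a b p q .{{_ : NonZero b}} .{{_ : NonZero q}} →
  a * q ≤ p * b → (ℤ.+ a / b) ≤ℚ (ℤ.+ p / q)
*≤*⇒/≤/ a b@(suc b-1) p q@(suc q-1) aq≤pb = toℚᵘ-cancel-≤ (begin
  toℚᵘ (ℤ.+ a / b)   ≃⟨ toℚᵘ-fromℚᵘ (mkℚᵘ (ℤ.+ a) b-1) ⟩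
  mkℚᵘ (ℤ.+ a) b-1   ≤⟨ *≤* (subst₂ ℤ._≤_ (pos-* a q) (pos-* p b) (+≤+ aq≤pb)) ⟩
  mkℚᵘ (ℤ.+ p) q-1   ≃⟨ toℚᵘ-fromℚᵘ (mkℚᵘ (ℤ.+ p) q-1) ⟨
  toℚᵘ (ℤ.+ p / q)   ∎)
  where open ℚᵘ.≤-Reasoning

lemma3p3 : (n k : ℕ) → .{{_ : NonZero n}} → 1 ≤ k → k ≤ n →
    (lowerQ n k ≤ℚ middleQ n k) × (middleQ n k ≤ℚ upperQ n k)
lemma3p3 n (suc j) {{n≢0}} _ k≤n =
  *≤*⇒/≤/ ((n ∸ suc j) !) (n * n !) (c n (suc j)) (n !) {{m*n≢0 n (n !) {{n≢0}} {{n !≢0}}}} {{n !≢0}}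
    (*-mono-≤ lower (m≤n*m (n !) n {{n≢0}})) ,
  *≤*⇒/≤/ (c n (suc j)) (n !) (2 ^ n) (suc j !) {{n !≢0}} {{suc j !≢0}} (c-upper n (suc j))
  where
  lower : (n ∸ suc j) ! ≤ c n (suc j)
  lower = subst (λ t → (n ∸ suc j) ! ≤ c t (suc j)) (m+[n∸m]≡n k≤n) (c-lower j (n ∸ suc j))
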